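{- Let $G$ be a finite simple graph with at least one isolated vertex such that $G \neq \widetilde G$ (i.e. $G$ has a pair of distinct twin vertices). If $G$ has a minimum twin cover that is also a determining set for $G$, then for $t \geq 1$, $\det(\mu_t(G)) = (t+1)\det(G) + t - 1$.
   Context: Two vertices $x,y$ are twins if they have the same open neighborhood; $\widetilde G$ is the quotient graph whose vertices are the twin-equivalence classes, two classes adjacent iff some members are adjacent in $G$. A minimum twin cover is a minimum size set of vertices containing at least one vertex of every pair of twin vertices. For a finite simple graph $G$ with $V(G)=\{v_1,\dots,v_n\}$ and $t\ge 1$, the generalized Mycielskian $\mu_t(G)$ has vertex set $\{u_i^s : 1\le i\le n,\ 0\le s\le t\}\cup\{w\}$, where $u_i^0=v_i$. For each edge $v_iv_j$ of $G$, $\mu_t(G)$ has the edge $u_i^0u_j^0$ and the edges $u_i^su_j^{s+1}$ and $u_j^su_i^{s+1}$ for $0\le s<t$; in addition $u_i^t w$ is an edge for every $i$. There are no other edges. A determining set is a vertex subset such that the only automorphism fixing each of its vertices is the identity; $\det(G)$ is the minimum size of a determining set. -}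

module Defs where

open import Data.Nat using (ℕ; zero; suc; _+_; _*_; _∸_; _≤_)
open import Data.Nat.Properties using (_≟_)
open import Data.Fin using (Fin; zero; suc; toℕ; remQuot; fromℕ)
open import Data.Fin.Subset using (Subset; _∈_; ∣_∣)
open import Data.Bool using (Bool; true; false; _∧_; _∨_; not; T)
open import Data.Sum using (_⊎_)
open import Data.Product using (Σ; ∃; _×_; _,_; proj₁; proj₂)
open import Relation.Binary.PropositionalEquality using (_≡_; _≢_)
open import Relation.Nullary.Decidable using (⌊_⌋)

record Graph : Set where
  constructor mkGraph
  field
    n     : ℕ
    adj   : Fin n → Fin n → Bool
open Graph public

IsSimple : Graph → Set
IsSimple G = (∀ i j → adj G i j ≡ adj G j i) × (∀ i → adj G i i ≡ false)

Isolated : (G : Graph) → Fin (n G) → Set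
Isolated G x = ∀ y → adj G x y ≡ false

Twins : (G : Graph) → Fin (n G) → Fin (n G) → Set
Twins G x y = ∀ z → adj G x z ≡ adj G y z

HasDistinctTwins : Graph → Set
HasDistinctTwins G = Σ (Fin (n G)) λ x → Σ (Fin (n G)) λ y → x ≢ y × Twins G x y

record Automorphism (G : Graph) : Set where
  field
    f      : Fin (n G) → Fin (n G)
    g      : Fin (n G) → Fin (n G)
    f∘g    : ∀ x → f (g x) ≡ x
    g∘f    : ∀ x → g (f x) ≡ x
    preserves : ∀ x y → adj G (f x) (f y) ≡ adj G x y
open Automorphism public

IsDeterminingSet : (G : Graph) → Subset (n G) → Set
IsDeterminingSet G S =
  (φ : Automorphism G) → (∀ x → x ∈ S → f φ x ≡ x) → ∀ x → f φ x ≡ x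

IsDetNumber : Graph → ℕ → Set
IsDetNumber G d =
  Σ (Subset (n G)) (λ S → IsDeterminingSet G S × ∣ S ∣ ≡ d)
  × (∀ S → IsDeterminingSet G S → d ≤ ∣ S ∣)

IsTwinCover : (G : Graph) → Subset (n G) → Set
IsTwinCover G S = ∀ x y → x ≢ y → Twins G x y → (x ∈ S) ⊎ (y ∈ S)

IsMinTwinCover : (G : Graph) → Subset (n G) → Set
IsMinTwinCover G S = IsTwinCover G S × (∀ T → IsTwinCover G T → ∣ S ∣ ≤ ∣ T ∣)

-- Generalized Mycielskian μ_t(G).
-- Vertex set Fin (suc ((suc t) * n)): vertex zero is w, and vertex
-- suc k with remQuot n k = (s , i) is u_i^s  (s : Fin (suc t), i : Fin n;
-- u_i^0 = v_i).

layerAdj : ℕ → ℕ → Bool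
layerAdj zero    zero     = true
layerAdj s       s'       = ⌊ s' ≟ suc s ⌋ ∨ ⌊ s ≟ suc s' ⌋

isTop : (t : ℕ) → Fin (suc t) → Bool
isTop t s = ⌊ toℕ s ≟ t ⌋

μadj : (t : ℕ) (G : Graph) → Fin (suc (suc t * n G)) → Fin (suc (suc t * n G)) → Bool
μadj t G zero    zero    = false
μadj t G zero    (suc k) = isTop t (proj₁ (remQuot {suc t} (n G) k))
μadj t G (suc k) zero    = isTop t (proj₁ (remQuot {suc t} (n G) k))
μadj t G (suc k) (suc l) with remQuot {suc t} (n G) k | remQuot {suc t} (n G) l
... | (s , i) | (s' , j) = adj G i j ∧ layerAdj (toℕ s) (toℕ s')

μ : ℕ → Graph → Graph
μ t G = mkGraph (suc (suc t * n G)) (μadj t G)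

-- A determining set D of μ_t(G) is a twin cover, and twins of G stay twins inside
-- every layer, so every layer of D is a twin cover of G and has at least |S| = det(G) elements
-- (determining sets are twin covers, and the minimum twin cover S is determining). The copies of
-- the isolated vertices of G in the layers below the top are isolated in μ_t(G), hence pairwise
-- twins, so D misses at most one of them. Every layer other than that one and the top therefore
-- contains all isolated vertices of G, and dropping one of them still leaves a twin cover; such
-- layers have more than det(G) elements, which gives |D| ≥ (t+1) det(G) + t − 1.
--
-- S misses exactly one isolated vertex i₀; take S in every layer and add i₀ in the
-- layers 1, …, t−1. An automorphism fixing this set fixes w, the only vertex that is the sole
-- neighbour of another vertex. It keeps every vertex with non-isolated base in its layer, since
-- the distance of u_x^s from w is t − s + 1. Copies of isolated vertices are isolated or have w
-- as sole neighbour, and only one vertex of each kind lies outside the set, so they are fixed.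
-- On layer 0 it induces an automorphism of G fixing S, hence the identity; and if layer s is
-- fixed, a vertex of layer s+1 and its image have the same neighbours in layer s, so their bases
-- are twins in G, one of which lies in S.

module Submission where

open import Defs
open import Data.Bool using (Bool; true; false; _∧_)
open import Data.Bool.Properties using (¬-not; ∨-comm; ∧-identityʳ) renaming (_≟_ to _≟ᵇ_)
open import Data.Fin using (Fin; zero; suc; toℕ; fromℕ; inject₁; lower₁; combine; remQuot)
open import Data.Fin.Induction using (<-weakInduction)
open import Data.Fin.Permutation.Components using (transpose; transpose-inverse)
open import Data.Fin.Properties
  using (_≟_; any?; all?; toℕ≤pred[n]; toℕ-fromℕ; toℕ-inject₁; toℕ-lower₁; toℕ-injective; remQuot-combine; combine-remQuot)
  renaming (suc-injective to fsuc-injective)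
open import Data.Fin.Subset using (Subset; _∈_; _∉_; _⊆_; ∣_∣; _∪_; _-_; ⁅_⁆; inside; outside)
open import Data.Fin.Subset.Properties
  using (_∈?_; drop-there; p⊆p∪q; x∈p∪q⁺; x∈⁅x⁆; ∪-identityʳ; ∣⁅x⁆∣≡1; ∣p∣≤∣x∷p∣; x∈p∧x≢y⇒x∈p-y; x∈p⇒∣p-x∣<∣p∣)
open import Data.Nat using (ℕ; zero; suc; _+_; _*_; _∸_; _≤_; _<_; z≤n; s≤s)
open import Data.Nat.Properties
  using ( ≤-refl; ≤-trans; ≤-reflexive; ≤-antisym; ≤-pred; <-irrefl; <⇒≢; n≤1+n; m≤n⇒m≤1+n; m≤n+m; m<n⇒m<1+n
        ; +-comm; +-assoc; +-suc; +-identityʳ; +-mono-≤; +-monoʳ-≤; +-cancelʳ-≤; m+1+n≢m; m+[n∸m]≡n; m≤n+o⇒m∸n≤o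
        ; +-commutativeSemigroup; module ≤-Reasoning)
  renaming (_≟_ to _≟ℕ_)
open import Data.Nat.Solver using (module +-*-Solver)
open import Data.Product using (Σ; ∃; ∃₂; _×_; _,_; proj₁; proj₂)
open import Data.Product.Properties using (,-injective)
open import Data.Sum using (_⊎_; inj₁; inj₂)
open import Data.Vec using (Vec; []; _∷_; _++_; concat; group; lookup; here; there)
open import Data.Vec.Properties using (lookup-concat; lookup⇒[]=; []=⇒lookup)
open import Function using (_∘_; id)
open import Level using (0ℓ)
open import Relation.Binary.PropositionalEquality
open import Relation.Nullary using (¬_; ¬?; Dec; contradiction; yes; no)
open import Relation.Nullary.Decidable using (⌊_⌋; _×-dec_; decidable-stable)
open import Relation.Unary using (Pred; Decidable)

open import Algebra.Properties.CommutativeSemigroup +-commutativeSemigroup using (x∙yz≈y∙xz)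

-- Counting subsets

∣p++q∣≡∣p∣+∣q∣ : ∀ {m k} (p : Subset m) (q : Subset k) → ∣ p ++ q ∣ ≡ ∣ p ∣ + ∣ q ∣
∣p++q∣≡∣p∣+∣q∣ []            q = refl
∣p++q∣≡∣p∣+∣q∣ (inside  ∷ p) q = cong suc (∣p++q∣≡∣p∣+∣q∣ p q)
∣p++q∣≡∣p∣+∣q∣ (outside ∷ p) q = ∣p++q∣≡∣p∣+∣q∣ p q

∣p∪q∣≤∣p∣+∣q∣ : ∀ {m} (p q : Subset m) → ∣ p ∪ q ∣ ≤ ∣ p ∣ + ∣ q ∣
∣p∪q∣≤∣p∣+∣q∣ []            []            = z≤n
∣p∪q∣≤∣p∣+∣q∣ (inside  ∷ p) (inside  ∷ q) =
  s≤s (≤-trans (m≤n⇒m≤1+n (∣p∪q∣≤∣p∣+∣q∣ p q)) (≤-reflexive (sym (+-suc ∣ p ∣ ∣ q ∣))))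
∣p∪q∣≤∣p∣+∣q∣ (inside  ∷ p) (outside ∷ q) = s≤s (∣p∪q∣≤∣p∣+∣q∣ p q)
∣p∪q∣≤∣p∣+∣q∣ (outside ∷ p) (inside  ∷ q) =
  ≤-trans (s≤s (∣p∪q∣≤∣p∣+∣q∣ p q)) (≤-reflexive (sym (+-suc ∣ p ∣ ∣ q ∣)))
∣p∪q∣≤∣p∣+∣q∣ (outside ∷ p) (outside ∷ q) = ∣p∪q∣≤∣p∣+∣q∣ p q

∣p∪⁅x⁆∣≡1+∣p∣ : ∀ {m} {x : Fin m} (p : Subset m) → x ∉ p → ∣ p ∪ ⁅ x ⁆ ∣ ≡ suc ∣ p ∣
∣p∪⁅x⁆∣≡1+∣p∣ {x = zero}  (inside  ∷ p) x∉p = contradiction here x∉p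
∣p∪⁅x⁆∣≡1+∣p∣ {x = zero}  (outside ∷ p) x∉p = cong (λ q → suc ∣ q ∣) (∪-identityʳ p)
∣p∪⁅x⁆∣≡1+∣p∣ {x = suc x} (inside  ∷ p) x∉p = cong suc (∣p∪⁅x⁆∣≡1+∣p∣ p (λ x∈p → x∉p (there x∈p)))
∣p∪⁅x⁆∣≡1+∣p∣ {x = suc x} (outside ∷ p) x∉p = ∣p∪⁅x⁆∣≡1+∣p∣ p (λ x∈p → x∉p (there x∈p))

∣concat∣-lowerBound : ∀ {m k d} (xss : Vec (Subset m) k) (E : Subset k)
  → (∀ s → d ≤ ∣ lookup xss s ∣)
  → (∀ s → s ∉ E → suc d ≤ ∣ lookup xss s ∣)
  → k * suc d ≤ ∣ E ∣ + ∣ concat xss ∣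
∣concat∣-lowerBound []         []      _     _        = z≤n
∣concat∣-lowerBound {k = suc k} {d} (xs ∷ xss) (b ∷ E) all≥d others>d
  rewrite ∣p++q∣≡∣p∣+∣q∣ xs (concat xss) = add-head b (others>d zero)
  where
  rest : k * suc d ≤ ∣ E ∣ + ∣ concat xss ∣
  rest = ∣concat∣-lowerBound xss E (all≥d ∘ suc) (λ s → others>d (suc s) ∘ (_∘ drop-there))
  add-head : ∀ b → (zero ∉ b ∷ E → suc d ≤ ∣ xs ∣) → suc k * suc d ≤ ∣ b ∷ E ∣ + (∣ xs ∣ + ∣ concat xss ∣)
  add-head inside  _     = ≤-trans (+-mono-≤ (s≤s (all≥d zero)) rest)
    (≤-reflexive (cong suc (x∙yz≈y∙xz (∣ xs ∣) (∣ E ∣) (∣ concat xss ∣))))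
  add-head outside head> = ≤-trans (+-mono-≤ (head> λ ()) rest)
    (≤-reflexive (x∙yz≈y∙xz (∣ xs ∣) (∣ E ∣) (∣ concat xss ∣)))

atMostOne⇒allButOne : ∀ {k} {P : Pred (Fin (suc k)) 0ℓ} → Decidable P
  → (∀ {a b} → P a → P b → a ≡ b) → ∃ λ s₀ → ∀ s → s ≢ s₀ → ¬ P s
atMostOne⇒allButOne P? unique with any? P?
... | yes (s₀ , Ps₀) = s₀ , λ s s≢s₀ Ps → s≢s₀ (unique Ps Ps₀)
... | no  ¬∃P        = zero , λ s _ Ps → ¬∃P (s , Ps)

[1+t][1+d]≤2+m⇒[t+1]d+t∸1≤m : ∀ t d m → suc t * suc d ≤ 2 + m → (t + 1) * d + t ∸ 1 ≤ m
[1+t][1+d]≤2+m⇒[t+1]d+t∸1≤m t d m le = subst (_≤ m) (sym lhs≡) (m≤n+o⇒m∸n≤o (suc t * suc d) 2 le)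
  where
  open +-*-Solver
  lhs≡ : (t + 1) * d + t ∸ 1 ≡ suc t * suc d ∸ 2
  lhs≡ = cong (_∸ 1) (solve 2 (λ t d → (t :+ con 1) :* d :+ t := d :+ t :* (con 1 :+ d)) refl t d)

d+[t*[1+d]+d]≡[2+t]d+[1+t]∸1 : ∀ t d → d + (t * suc d + d) ≡ (suc t + 1) * d + suc t ∸ 1
d+[t*[1+d]+d]≡[2+t]d+[1+t]∸1 t d = begin
  d + (t * suc d + d)                ≡⟨ solve 2 (λ t d → d :+ (t :* (con 1 :+ d) :+ d) := (con 1 :+ t :+ con 1) :* d :+ t) refl t d ⟩
  (suc t + 1) * d + t                ≡⟨ cong (_∸ 1) (+-suc ((suc t + 1) * d) t) ⟨
  (suc t + 1) * d + suc t ∸ 1        ∎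
  where
  open +-*-Solver
  open ≡-Reasoning

-- Graphs, twins and automorphisms

Adjacent : (H : Graph) → Fin (n H) → Fin (n H) → Set
Adjacent H a b = adj H a b ≡ true

NonIsolated : (H : Graph) → Fin (n H) → Set
NonIsolated H x = ∃ (Adjacent H x)

SoleNeighbour : (H : Graph) → Fin (n H) → Fin (n H) → Set
SoleNeighbour H v a = Adjacent H v a × (∀ b → Adjacent H v b → b ≡ a)

Branching : (H : Graph) → Fin (n H) → Set
Branching H v = ∃₂ λ b c → Adjacent H v b × Adjacent H v c × b ≢ c

Symmetric : Graph → Set
Symmetric H = ∀ a b → adj H a b ≡ adj H b a

module _ (H : Graph) where

  branching⇒¬soleNeighbour : ∀ v a → Branching H v → ¬ SoleNeighbour H v a
  branching⇒¬soleNeighbour _ _ (b , c , v~b , v~c , b≢c) (_ , sole) = b≢c (trans (sole b v~b) (sym (sole c v~c)))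

  isolated⇒¬nonIsolated : ∀ {v} → Isolated H v → ¬ NonIsolated H v
  isolated⇒¬nonIsolated iso (b , v~b) = contradiction (trans (sym (iso b)) v~b) λ ()

  twins⇒isolated : ∀ {x y} → Twins H x y → Isolated H x → Isolated H y
  twins⇒isolated tw iso z = trans (sym (tw z)) (iso z)

  isolated⇒twins : ∀ {x y} → Isolated H x → Isolated H y → Twins H x y
  isolated⇒twins isoˣ isoʸ z = trans (isoˣ z) (sym (isoʸ z))

  isolated? : ∀ v → Dec (Isolated H v)
  isolated? v = all? λ b → adj H v b ≟ᵇ false

  isolated⊎nonIsolated : ∀ v → Isolated H v ⊎ NonIsolated H v
  isolated⊎nonIsolated v with any? (λ b → adj H v b ≟ᵇ true)
  ... | yes nonIso = inj₂ nonIso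
  ... | no ¬nonIso = inj₁ λ b → ¬-not λ v~b → ¬nonIso (b , v~b)

  twins-sym : ∀ {x y} → Twins H x y → Twins H y x
  twins-sym tw z = sym (tw z)

  twinCover-remove : ∀ {T x} → IsTwinCover H T → (∀ y → y ≢ x → Twins H x y → y ∈ T)
    → IsTwinCover H (T - x)
  twinCover-remove {x = x} cover twins∈T a b a≢b tw with cover a b a≢b tw
  ... | inj₁ a∈T with a ≟ x
  ...   | no  a≢x  = inj₁ (x∈p∧x≢y⇒x∈p-y a∈T a≢x)
  ...   | yes refl = inj₂ (x∈p∧x≢y⇒x∈p-y (twins∈T b (a≢b ∘ sym) tw) (a≢b ∘ sym))
  twinCover-remove {x = x} cover twins∈T a b a≢b tw | inj₂ b∈T with b ≟ x
  ...   | no  b≢x  = inj₂ (x∈p∧x≢y⇒x∈p-y b∈T b≢x)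
  ...   | yes refl = inj₁ (x∈p∧x≢y⇒x∈p-y (twins∈T a a≢b (twins-sym tw)) a≢b)

  isolated-outside-twinCover : ∀ {T x y} → IsTwinCover H T
    → Isolated H x → Isolated H y → x ∉ T → y ∉ T → x ≡ y
  isolated-outside-twinCover {x = x} {y} cover isoˣ isoʸ x∉T y∉T with x ≟ y
  ... | yes x≡y = x≡y
  ... | no  x≢y with cover x y x≢y (isolated⇒twins isoˣ isoʸ)
  ...   | inj₁ x∈T = contradiction x∈T x∉T
  ...   | inj₂ y∈T = contradiction y∈T y∉T

module _ {H : Graph} (φ : Automorphism H) where

  f-injective : ∀ {a b} → f φ a ≡ f φ b → a ≡ b
  f-injective {a} {b} φa≡φb = trans (sym (g∘f φ a)) (trans (cong (g φ) φa≡φb) (g∘f φ b))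

  adj-image : ∀ a b → adj H (f φ a) b ≡ adj H a (g φ b)
  adj-image a b = trans (cong (adj H (f φ a)) (sym (f∘g φ b))) (preserves φ a (g φ b))

  isolated-image : ∀ v → Isolated H v → Isolated H (f φ v)
  isolated-image v iso b = trans (adj-image v b) (iso (g φ b))

  soleNeighbour-image : ∀ v a → SoleNeighbour H v a → SoleNeighbour H (f φ v) (f φ a)
  soleNeighbour-image v a (v~a , sole) =
    trans (preserves φ v a) v~a ,
    λ b φv~b → trans (sym (f∘g φ b)) (cong (f φ) (sole (g φ b) (trans (sym (adj-image v b)) φv~b)))

  branching-image : ∀ v → Branching H v → Branching H (f φ v)
  branching-image v (b , c , v~b , v~c , b≢c) =
    f φ b , f φ c , trans (preserves φ v b) v~b , trans (preserves φ v c) v~c , b≢c ∘ f-injective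

  module _ {D : Subset (n H)} (fixesD : ∀ v → v ∈ D → f φ v ≡ v) where

    image∈⇒fixed : ∀ {v} → f φ v ∈ D → f φ v ≡ v
    image∈⇒fixed {v} φv∈D = f-injective (fixesD (f φ v) φv∈D)

    fixes-class-with-one-outsider : (P : Pred (Fin (n H)) 0ℓ) → (∀ {v} → P v → P (f φ v))
      → (∀ {v v′} → P v → P v′ → v ∉ D → v′ ∉ D → v ≡ v′)
      → ∀ {v} → P v → f φ v ≡ v
    fixes-class-with-one-outsider P invariant unique {v} Pv with v ∈? D | f φ v ∈? D
    ... | yes v∈D | _        = fixesD v v∈D
    ... | no  _   | yes φv∈D = image∈⇒fixed φv∈D
    ... | no  v∉D | no  φv∉D = unique (invariant Pv) Pv φv∉D v∉D

_⁻¹ : ∀ {H} → Automorphism H → Automorphism H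
_⁻¹ {H} φ = record
  { f = g φ ; g = f φ ; f∘g = g∘f φ ; g∘f = f∘g φ
  ; preserves = λ a b → trans (sym (adj-image φ (g φ a) b)) (cong (λ c → adj H c b) (f∘g φ a)) }

transpose-cases : ∀ {m} (i j k : Fin m)
  → (k ≡ i × transpose i j k ≡ j)
  ⊎ (k ≡ j × transpose i j k ≡ i)
  ⊎ (k ≢ i × k ≢ j × transpose i j k ≡ k)
transpose-cases i j k with k ≟ i
... | yes k≡i = inj₁ (k≡i , refl)
... | no  k≢i with k ≟ j
...   | yes k≡j = inj₂ (inj₁ (k≡j , refl))
...   | no  k≢j = inj₂ (inj₂ (k≢i , k≢j , refl))

module _ {H : Graph} (symH : Symmetric H) {x y : Fin (n H)} (tw : Twins H x y) where

  transpose-twin : ∀ k → Twins H (transpose x y k) k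
  transpose-twin k with transpose-cases x y k
  ... | inj₁ (refl , τk≡y)         rewrite τk≡y = twins-sym H tw
  ... | inj₂ (inj₁ (refl , τk≡x))  rewrite τk≡x = tw
  ... | inj₂ (inj₂ (_ , _ , τk≡k)) rewrite τk≡k = λ _ → refl

  twinSwap : Automorphism H
  twinSwap = record
    { f = transpose x y ; g = transpose y x
    ; f∘g = λ _ → transpose-inverse x y ; g∘f = λ _ → transpose-inverse y x
    ; preserves = λ a b → begin
        adj H (transpose x y a) (transpose x y b) ≡⟨ transpose-twin a (transpose x y b) ⟩
        adj H a (transpose x y b)                 ≡⟨ symH a _ ⟩
        adj H (transpose x y b) a                 ≡⟨ transpose-twin b a ⟩
        adj H b a                                 ≡⟨ symH b a ⟩
        adj H a b                                 ∎ }
    where open ≡-Reasoning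

determining⇒twinCover : ∀ {H D} → Symmetric H → IsDeterminingSet H D → IsTwinCover H D
determining⇒twinCover {H} {D} symH det x y x≢y tw with x ∈? D | y ∈? D
... | yes x∈D | _       = inj₁ x∈D
... | no  _   | yes y∈D = inj₂ y∈D
... | no  x∉D | no  y∉D = contradiction (det (twinSwap symH tw) fixesD x) swap-moves-x
  where
  fixesD : ∀ v → v ∈ D → transpose x y v ≡ v
  fixesD v v∈D with transpose-cases x y v
  ... | inj₁ (refl , _)            = contradiction v∈D x∉D
  ... | inj₂ (inj₁ (refl , _))     = contradiction v∈D y∉D
  ... | inj₂ (inj₂ (_ , _ , τv≡v)) = τv≡v
  swap-moves-x : transpose x y x ≢ x
  swap-moves-x with transpose-cases x y x
  ... | inj₁ (_ , τx≡y)            = λ τx≡x → x≢y (trans (sym τx≡x) τx≡y)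
  ... | inj₂ (inj₁ (x≡y , _))      = contradiction x≡y x≢y
  ... | inj₂ (inj₂ (x≢x , _ , _))  = contradiction refl x≢x

ReachableWithin : (H : Graph) → Fin (n H) → ℕ → Fin (n H) → Set
ReachableWithin H r zero    v = v ≡ r
ReachableWithin H r (suc m) v = ReachableWithin H r m v ⊎ ∃ λ a → ReachableWithin H r m a × Adjacent H a v

reachableWithin-image : ∀ {H r} (φ : Automorphism H) → f φ r ≡ r
  → ∀ {m v} → ReachableWithin H r m v → ReachableWithin H r m (f φ v)
reachableWithin-image φ φr≡r {zero}  refl                   = φr≡r
reachableWithin-image φ φr≡r {suc m} (inj₁ r↝v)             = inj₁ (reachableWithin-image φ φr≡r r↝v)
reachableWithin-image φ φr≡r {suc m} (inj₂ (a , r↝a , a~v)) =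
  inj₂ (f φ a , reachableWithin-image φ φr≡r r↝a , trans (preserves φ a _) a~v)

-- The generalized Mycielskian

∧≡true⁻ : ∀ a b → a ∧ b ≡ true → a ≡ true × b ≡ true
∧≡true⁻ true true _ = refl , refl

layerAdj-sym : ∀ a b → layerAdj a b ≡ layerAdj b a
layerAdj-sym zero    zero    = refl
layerAdj-sym zero    (suc b) = ∨-comm ⌊ suc b ≟ℕ 1 ⌋ ⌊ 0 ≟ℕ suc (suc b) ⌋
layerAdj-sym (suc a) zero    = ∨-comm ⌊ 0 ≟ℕ suc (suc a) ⌋ ⌊ suc a ≟ℕ 1 ⌋
layerAdj-sym (suc a) (suc b) = ∨-comm ⌊ suc b ≟ℕ suc (suc a) ⌋ ⌊ suc a ≟ℕ suc (suc b) ⌋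

layerAdj-suc : ∀ a → layerAdj a (suc a) ≡ true
layerAdj-suc zero    = refl
layerAdj-suc (suc a) with suc (suc a) ≟ℕ suc (suc a)
... | yes _   = refl
... | no  a≢a = contradiction refl a≢a

layerAdj-pred : ∀ a → layerAdj (suc a) a ≡ true
layerAdj-pred a = trans (layerAdj-sym (suc a) a) (layerAdj-suc a)

layerAdj⇒≤suc : ∀ a b → layerAdj a b ≡ true → a ≤ suc b
layerAdj⇒≤suc zero    b       _ = z≤n
layerAdj⇒≤suc (suc a) b adjacent with b ≟ℕ suc (suc a) | suc a ≟ℕ suc b
... | yes refl | _        = s≤s (m≤n⇒m≤1+n (n≤1+n a))
... | no  _    | yes refl = ≤-refl
... | no  _    | no  _    = contradiction adjacent λ ()

module Mycielskian (t : ℕ) (G : Graph) (symG : Symmetric G) where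

  μG : Graph
  μG = μ t G

  V : Set
  V = Fin (n μG)

  w : V
  w = zero

  u : Fin (suc t) → Fin (n G) → V
  u s i = suc (combine s i)

  data View : V → Set where
    w-view : View w
    u-view : ∀ s i → View (u s i)

  view : ∀ v → View v
  view zero    = w-view
  view (suc k) = subst (λ k → View (suc k)) (combine-remQuot {suc t} (n G) k)
    (u-view (proj₁ (remQuot {suc t} (n G) k)) (proj₂ (remQuot {suc t} (n G) k)))

  u-injective : ∀ s i s′ j → u s i ≡ u s′ j → s ≡ s′ × i ≡ j
  u-injective s i s′ j us≡us′ = ,-injective (begin
    (s , i)                           ≡⟨ remQuot-combine s i ⟨
    remQuot (n G) (combine s i)       ≡⟨ cong (remQuot (n G)) (fsuc-injective us≡us′) ⟩
    remQuot (n G) (combine s′ j)      ≡⟨ remQuot-combine s′ j ⟩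
    (s′ , j)                          ∎)
    where open ≡-Reasoning

  adj-w-u : ∀ s i → adj μG w (u s i) ≡ isTop t s
  adj-w-u s i = cong (isTop t ∘ proj₁) (remQuot-combine {suc t} {n G} s i)

  adj-u-w : ∀ s i → adj μG (u s i) w ≡ isTop t s
  adj-u-w s i = cong (isTop t ∘ proj₁) (remQuot-combine {suc t} {n G} s i)

  adj-u-u : ∀ s i s′ j → adj μG (u s i) (u s′ j) ≡ adj G i j ∧ layerAdj (toℕ s) (toℕ s′)
  adj-u-u s i s′ j = trans (adj-suc-suc _ _) (cong₂ adjₚ (remQuot-combine s i) (remQuot-combine s′ j))
    where
    adjₚ : Fin (suc t) × Fin (n G) → Fin (suc t) × Fin (n G) → Bool
    adjₚ (s , i) (s′ , j) = adj G i j ∧ layerAdj (toℕ s) (toℕ s′)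
    adj-suc-suc : ∀ k l → adj μG (suc k) (suc l) ≡ adjₚ (remQuot (n G) k) (remQuot (n G) l)
    adj-suc-suc k l with remQuot {suc t} (n G) k | remQuot {suc t} (n G) l
    ... | _ | _ = refl

  isTop⇒top : ∀ s → isTop t s ≡ true → toℕ s ≡ t
  isTop⇒top s isTop≡true with toℕ s ≟ℕ t
  ... | yes top = top
  ... | no  _   = contradiction isTop≡true λ ()

  top⇒isTop : ∀ s → toℕ s ≡ t → isTop t s ≡ true
  top⇒isTop s top with toℕ s ≟ℕ t
  ... | yes _    = refl
  ... | no  ¬top = contradiction top ¬top

  adjacent-w-u⇒top : ∀ s i → Adjacent μG w (u s i) → toℕ s ≡ t
  adjacent-w-u⇒top s i w~u = isTop⇒top s (trans (sym (adj-w-u s i)) w~u)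

  adjacent-u-w⇒top : ∀ s i → Adjacent μG (u s i) w → toℕ s ≡ t
  adjacent-u-w⇒top s i u~w = isTop⇒top s (trans (sym (adj-u-w s i)) u~w)

  top⇒adjacent-w-u : ∀ s i → toℕ s ≡ t → Adjacent μG w (u s i)
  top⇒adjacent-w-u s i top = trans (adj-w-u s i) (top⇒isTop s top)

  top⇒adjacent-u-w : ∀ s i → toℕ s ≡ t → Adjacent μG (u s i) w
  top⇒adjacent-u-w s i top = trans (adj-u-w s i) (top⇒isTop s top)

  adjacent-u-u⁻ : ∀ s i s′ j → Adjacent μG (u s i) (u s′ j)
    → Adjacent G i j × layerAdj (toℕ s) (toℕ s′) ≡ true
  adjacent-u-u⁻ s i s′ j u~u = ∧≡true⁻ _ _ (trans (sym (adj-u-u s i s′ j)) u~u)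

  adjacent-u-u⁺ : ∀ s i s′ j → Adjacent G i j → layerAdj (toℕ s) (toℕ s′) ≡ true
    → Adjacent μG (u s i) (u s′ j)
  adjacent-u-u⁺ s i s′ j i~j s~s′ = trans (adj-u-u s i s′ j) (cong₂ _∧_ i~j s~s′)

  symmetric : Symmetric μG
  symmetric a b with view a | view b
  ... | w-view     | w-view     = refl
  ... | w-view     | u-view s i = trans (adj-w-u s i) (sym (adj-u-w s i))
  ... | u-view s i | w-view     = trans (adj-u-w s i) (sym (adj-w-u s i))
  ... | u-view s i | u-view s′ j = begin
    adj μG (u s i) (u s′ j)                      ≡⟨ adj-u-u s i s′ j ⟩
    adj G i j ∧ layerAdj (toℕ s) (toℕ s′)        ≡⟨ cong₂ _∧_ (symG i j) (layerAdj-sym (toℕ s) (toℕ s′)) ⟩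
    adj G j i ∧ layerAdj (toℕ s′) (toℕ s)        ≡⟨ adj-u-u s′ j s i ⟨
    adj μG (u s′ j) (u s i)                      ∎
    where open ≡-Reasoning

  twins-lift : ∀ s {x y} → Twins G x y → Twins μG (u s x) (u s y)
  twins-lift s {x} {y} tw z with view z
  ... | w-view      = trans (adj-u-w s x) (sym (adj-u-w s y))
  ... | u-view s′ j = begin
    adj μG (u s x) (u s′ j)                  ≡⟨ adj-u-u s x s′ j ⟩
    adj G x j ∧ layerAdj (toℕ s) (toℕ s′)    ≡⟨ cong (_∧ layerAdj (toℕ s) (toℕ s′)) (tw j) ⟩
    adj G y j ∧ layerAdj (toℕ s) (toℕ s′)    ≡⟨ adj-u-u s y s′ j ⟨
    adj μG (u s y) (u s′ j)                  ∎
    where open ≡-Reasoning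

  isolated-lift : ∀ s x → toℕ s ≢ t → Isolated G x → Isolated μG (u s x)
  isolated-lift s x ¬top iso z with view z
  ... | w-view      = trans (adj-u-w s x) (¬-not (¬top ∘ isTop⇒top s))
  ... | u-view s′ j = trans (adj-u-u s x s′ j) (cong (_∧ layerAdj (toℕ s) (toℕ s′)) (iso j))

  neighbour-of-isolated : ∀ s x a → Isolated G x → Adjacent μG (u s x) a → a ≡ w
  neighbour-of-isolated s x a iso u~a with view a
  ... | w-view      = refl
  ... | u-view s′ j = contradiction (j , proj₁ (adjacent-u-u⁻ s x s′ j u~a)) (isolated⇒¬nonIsolated G iso)

  top : Fin (suc t)
  top = fromℕ t

  top-unique : ∀ (s : Fin (suc t)) → toℕ s ≡ t → s ≡ top
  top-unique s s≡t = toℕ-injective (trans s≡t (sym (toℕ-fromℕ t)))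

  layer-below : ∀ (s : Fin (suc t))
    → ∃ λ (r : Fin (suc t)) → toℕ r ≤ toℕ s × layerAdj (toℕ s) (toℕ r) ≡ true
  layer-below zero    = zero , z≤n , refl
  layer-below (suc s) = inject₁ s , ≤-trans (≤-reflexive (toℕ-inject₁ s)) (n≤1+n (toℕ s)) ,
    subst (λ a → layerAdj (suc (toℕ s)) a ≡ true) (sym (toℕ-inject₁ s)) (layerAdj-pred (toℕ s))

  layer-above : ∀ (s : Fin (suc t)) → toℕ s ≢ t
    → ∃ λ (r : Fin (suc t)) → toℕ r ≡ suc (toℕ s) × layerAdj (toℕ s) (toℕ r) ≡ true
  layer-above s ¬top = suc (lower₁ s (¬top ∘ sym)) , toℕ-above ,
    subst (λ a → layerAdj (toℕ s) a ≡ true) (sym toℕ-above) (layerAdj-suc (toℕ s))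
    where
    toℕ-above : toℕ (Fin.suc (lower₁ s (¬top ∘ sym))) ≡ suc (toℕ s)
    toℕ-above = cong suc (toℕ-lower₁ s (¬top ∘ sym))

  FixesLayer : Automorphism μG → Fin (suc t) → Set
  FixesLayer φ s = ∀ x → f φ (u s x) ≡ u s x

  adj-to-layer-below : ∀ (s : Fin t) i j → adj μG (u (suc s) i) (u (inject₁ s) j) ≡ adj G i j
  adj-to-layer-below s i j =
    trans (adj-u-u (suc s) i (inject₁ s) j)
      (trans (cong (adj G i j ∧_) (proj₂ (proj₂ (layer-below (suc s))))) (∧-identityʳ (adj G i j)))

  twins-from-layer-below : (φ : Automorphism μG) (s : Fin t) → FixesLayer φ (inject₁ s)
    → ∀ x y → f φ (u (suc s) x) ≡ u (suc s) y → Twins G x y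
  twins-from-layer-below φ s below-fixed x y φu≡u′ z = begin
    adj G x z                                                   ≡⟨ adj-to-layer-below s x z ⟨
    adj μG (u (suc s) x) (u (inject₁ s) z)                      ≡⟨ preserves φ _ _ ⟨
    adj μG (f φ (u (suc s) x)) (f φ (u (inject₁ s) z))          ≡⟨ cong₂ (adj μG) φu≡u′ (below-fixed z) ⟩
    adj μG (u (suc s) y) (u (inject₁ s) z)                      ≡⟨ adj-to-layer-below s y z ⟩
    adj G y z                                                   ∎
    where open ≡-Reasoning

  branching-u : ∀ s x → NonIsolated G x → Branching μG (u s x)
  branching-u s x (j , x~j) with layer-below s | toℕ s ≟ℕ t
  ... | r , _ , s~r | yes top =
    w , u r j , top⇒adjacent-u-w s x top , adjacent-u-u⁺ s x r j x~j s~r , λ ()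
  ... | r , r≤s , s~r | no ¬top with layer-above s ¬top
  ...   | r′ , r′≡1+s , s~r′ =
    u r′ j , u r j , adjacent-u-u⁺ s x r′ j x~j s~r′ , adjacent-u-u⁺ s x r j x~j s~r ,
    λ ur′≡ur → <⇒≢ (subst (toℕ r <_) (sym r′≡1+s) (s≤s r≤s))
                    (sym (cong toℕ (proj₁ (u-injective r′ j r j ur′≡ur))))

  branching⇒nonIsolated : ∀ s x → Branching μG (u s x) → NonIsolated G x
  branching⇒nonIsolated s x (b , c , u~b , u~c , b≢c) with isolated⊎nonIsolated G x
  ... | inj₂ nonIso = nonIso
  ... | inj₁ iso    =
    contradiction (trans (neighbour-of-isolated s x b iso u~b) (sym (neighbour-of-isolated s x c iso u~c))) b≢c

  -- For non-isolated x, the distance from w to u s x is exactly t − toℕ s + 1.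
  reach-u : ∀ k s x → toℕ s + k ≡ t → NonIsolated G x → ReachableWithin μG w (suc k) (u s x)
  reach-u zero    s x s+0≡t _ = inj₂ (w , refl , top⇒adjacent-w-u s x (trans (sym (+-identityʳ (toℕ s))) s+0≡t))
  reach-u (suc k) s x s+1+k≡t (j , x~j) with layer-above s (λ s≡t → m+1+n≢m (toℕ s) (trans s+1+k≡t (sym s≡t)))
  ... | r , r≡1+s , s~r =
    inj₂ (u r j , reach-u k r j r+k≡t (x , j~x) ,
          adjacent-u-u⁺ r j s x j~x (trans (layerAdj-sym (toℕ r) (toℕ s)) s~r))
    where
    j~x : Adjacent G j x
    j~x = trans (symG j x) x~j
    r+k≡t : toℕ r + k ≡ t
    r+k≡t = trans (cong (_+ k) r≡1+s) (trans (sym (+-suc (toℕ s) k)) s+1+k≡t)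

  reach-bound : ∀ m s x → ReachableWithin μG w m (u s x) → t < m + toℕ s
  reach-bound (suc m) s x (inj₁ w↝u) = m<n⇒m<1+n (reach-bound m s x w↝u)
  reach-bound (suc m) s x (inj₂ (a , w↝a , a~u)) with view a
  ... | w-view = subst (λ b → t < suc m + b) (sym (adjacent-w-u⇒top s x a~u)) (s≤s (m≤n+m t m))
  ... | u-view s′ j = begin-strict
    t                  <⟨ reach-bound m s′ j w↝a ⟩
    m + toℕ s′         ≤⟨ +-monoʳ-≤ m (layerAdj⇒≤suc (toℕ s′) (toℕ s) (proj₂ (adjacent-u-u⁻ s′ j s x a~u))) ⟩
    m + suc (toℕ s)    ≡⟨ +-suc m (toℕ s) ⟩
    suc m + toℕ s      ∎
    where open ≤-Reasoning

  layer-≤ : (ψ : Automorphism μG) → f ψ w ≡ w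
    → ∀ s x s′ y → NonIsolated G x → f ψ (u s x) ≡ u s′ y → toℕ s ≤ toℕ s′
  layer-≤ ψ ψw≡w s x s′ y nonIso ψu≡u′ = +-cancelʳ-≤ k (toℕ s) (toℕ s′) (begin
    toℕ s + k     ≡⟨ s+k≡t ⟩
    t             ≤⟨ ≤-pred (reach-bound (suc k) s′ y w↝u′) ⟩
    k + toℕ s′    ≡⟨ +-comm k (toℕ s′) ⟩
    toℕ s′ + k    ∎)
    where
    open ≤-Reasoning
    k : ℕ
    k = t ∸ toℕ s
    s+k≡t : toℕ s + k ≡ t
    s+k≡t = m+[n∸m]≡n (toℕ≤pred[n] s)
    w↝u′ : ReachableWithin μG w (suc k) (u s′ y)
    w↝u′ = subst (ReachableWithin μG w (suc k)) ψu≡u′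
      (reachableWithin-image ψ ψw≡w (reach-u k s x s+k≡t nonIso))

  layers : Subset (n μG) → Vec (Subset (n G)) (suc t)
  layers (_ ∷ D) = proj₁ (group (suc t) (n G) D)

  concat-layers : ∀ b D → D ≡ concat (layers (b ∷ D))
  concat-layers b D = proj₂ (group (suc t) (n G) D)

  ∈-layers : ∀ {D} s i → u s i ∈ D → i ∈ lookup (layers D) s
  ∈-layers {b ∷ D} s i (there ci∈D) = lookup⇒[]= i _ (begin
    lookup (lookup (layers (b ∷ D)) s) i          ≡⟨ lookup-concat (layers (b ∷ D)) s i ⟨
    lookup (concat (layers (b ∷ D))) (combine s i) ≡⟨ cong (λ E → lookup E (combine s i)) (concat-layers b D) ⟨
    lookup D (combine s i)                         ≡⟨ []=⇒lookup ci∈D ⟩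
    true                                           ∎)
    where open ≡-Reasoning

  ∣concat-layers∣≤∣D∣ : ∀ D → ∣ concat (layers D) ∣ ≤ ∣ D ∣
  ∣concat-layers∣≤∣D∣ (b ∷ D) = subst (_≤ ∣ b ∷ D ∣) (cong ∣_∣ (concat-layers b D)) (∣p∣≤∣x∷p∣ b D)

  fromLayers : Vec (Subset (n G)) (suc t) → Subset (n μG)
  fromLayers L = outside ∷ concat L

  ∈-fromLayers : ∀ L s i → i ∈ lookup L s → u s i ∈ fromLayers L
  ∈-fromLayers L s i i∈L[s] =
    there (lookup⇒[]= (combine s i) (concat L) (trans (lookup-concat L s i) ([]=⇒lookup i∈L[s])))

  restrict₀ : (φ : Automorphism μG)
    → (∀ x → ∃ λ y → f φ (u zero x) ≡ u zero y)
    → (∀ x → ∃ λ y → g φ (u zero x) ≡ u zero y)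
    → Σ (Automorphism G) λ π → ∀ x → f φ (u zero x) ≡ u zero (f π x)
  restrict₀ φ image inverse-image = π , λ x → proj₂ (image x)
    where
    adj₀ : ∀ a b → adj μG (u zero a) (u zero b) ≡ adj G a b
    adj₀ a b = trans (adj-u-u zero a zero b) (∧-identityʳ (adj G a b))
    layer₀-injective : ∀ {a b} → u zero a ≡ u zero b → a ≡ b
    layer₀-injective {a} {b} = proj₂ ∘ u-injective zero a zero b
    π : Automorphism G
    π = record
      { f = proj₁ ∘ image
      ; g = proj₁ ∘ inverse-image
      ; f∘g = λ x → layer₀-injective (begin
          u zero (proj₁ (image (proj₁ (inverse-image x))))  ≡⟨ proj₂ (image _) ⟨
          f φ (u zero (proj₁ (inverse-image x)))            ≡⟨ cong (f φ) (proj₂ (inverse-image x)) ⟨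
          f φ (g φ (u zero x))                              ≡⟨ f∘g φ (u zero x) ⟩
          u zero x                                          ∎)
      ; g∘f = λ x → layer₀-injective (begin
          u zero (proj₁ (inverse-image (proj₁ (image x))))  ≡⟨ proj₂ (inverse-image _) ⟨
          g φ (u zero (proj₁ (image x)))                    ≡⟨ cong (g φ) (proj₂ (image x)) ⟨
          g φ (f φ (u zero x))                              ≡⟨ g∘f φ (u zero x) ⟩
          u zero x                                          ∎)
      ; preserves = λ a b → begin
          adj G (proj₁ (image a)) (proj₁ (image b))                  ≡⟨ adj₀ _ _ ⟨
          adj μG (u zero (proj₁ (image a))) (u zero (proj₁ (image b))) ≡⟨ cong₂ (adj μG) (proj₂ (image a)) (proj₂ (image b)) ⟨
          adj μG (f φ (u zero a)) (f φ (u zero b))                   ≡⟨ preserves φ (u zero a) (u zero b) ⟩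
          adj μG (u zero a) (u zero b)                               ≡⟨ adj₀ a b ⟩
          adj G a b                                                  ∎ }
      where open ≡-Reasoning

  soleNeighbour-top : ∀ x → Isolated G x → SoleNeighbour μG (u top x) w
  soleNeighbour-top x iso = top⇒adjacent-u-w top x (toℕ-fromℕ t) , λ a → neighbour-of-isolated top x a iso

  soleNeighbour-w : ∀ v → SoleNeighbour μG v w → ∃ λ j → v ≡ u top j × Isolated G j
  soleNeighbour-w v (v~w , sole) with view v
  ... | w-view     = contradiction v~w λ ()
  ... | u-view s j with isolated⊎nonIsolated G j
  ...   | inj₁ iso    = j , cong (λ r → u r j) (top-unique s (adjacent-u-w⇒top s j v~w)) , iso
  ...   | inj₂ nonIso = contradiction (v~w , sole) (branching⇒¬soleNeighbour μG (u s j) w (branching-u s j nonIso))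

  module Rigidity {x₀ y₀ : Fin (n G)} (x₀≢y₀ : x₀ ≢ y₀) {i₁ : Fin (n G)} (iso₁ : Isolated G i₁) where

    w-branching : Branching μG w
    w-branching = u top x₀ , u top y₀ ,
      top⇒adjacent-w-u top x₀ (toℕ-fromℕ t) , top⇒adjacent-w-u top y₀ (toℕ-fromℕ t) ,
      x₀≢y₀ ∘ proj₂ ∘ u-injective top x₀ top y₀

    soleNeighbour≡w : ∀ v a → SoleNeighbour μG v a → a ≡ w
    soleNeighbour≡w v a sole with view v
    ... | w-view     = contradiction sole (branching⇒¬soleNeighbour μG w a w-branching)
    ... | u-view s x with isolated⊎nonIsolated G x
    ...   | inj₁ iso    = neighbour-of-isolated s x a iso (proj₁ sole)
    ...   | inj₂ nonIso = contradiction sole (branching⇒¬soleNeighbour μG (u s x) a (branching-u s x nonIso))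

    isolated-vertex : ∀ v → Isolated μG v → ∃₂ λ s j → v ≡ u s j × toℕ s ≢ t × Isolated G j
    isolated-vertex v iso with view v
    ... | w-view     = contradiction (trans (sym (iso (u top x₀))) (top⇒adjacent-w-u top x₀ (toℕ-fromℕ t))) λ ()
    ... | u-view s j with isolated⊎nonIsolated G j
    ...   | inj₁ isoʲ   =
      s , j , refl , (λ top → contradiction (trans (sym (iso w)) (top⇒adjacent-u-w s j top)) λ ()) , isoʲ
    ...   | inj₂ nonIso with branching-u s j nonIso
    ...     | b , _ , u~b , _ = contradiction (trans (sym (iso b)) u~b) λ ()

    w-fixed : ∀ (φ : Automorphism μG) → f φ w ≡ w
    w-fixed φ = soleNeighbour≡w (f φ (u top i₁)) (f φ w)
      (soleNeighbour-image φ (u top i₁) w (soleNeighbour-top i₁ iso₁))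

    layer-preserved : ∀ (ψ : Automorphism μG) s x → NonIsolated G x → ∃ λ y → f ψ (u s x) ≡ u s y
    layer-preserved ψ s x nonIso with f ψ (u s x) in ψu≡v
    ... | v with view v
    ...   | w-view      = contradiction (f-injective ψ (trans ψu≡v (sym (w-fixed ψ)))) λ ()
    ...   | u-view s′ y = y , cong (λ r → u r y) s′≡s
      where
      nonIsoʸ : NonIsolated G y
      nonIsoʸ = branching⇒nonIsolated s′ y
        (subst (Branching μG) ψu≡v (branching-image ψ (u s x) (branching-u s x nonIso)))
      ψ⁻¹u′≡u : g ψ (u s′ y) ≡ u s x
      ψ⁻¹u′≡u = trans (cong (g ψ) (sym ψu≡v)) (g∘f ψ (u s x))
      s′≡s : s′ ≡ s
      s′≡s = toℕ-injective (≤-antisym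
        (layer-≤ (ψ ⁻¹) (w-fixed (ψ ⁻¹)) s′ y s x nonIsoʸ ψ⁻¹u′≡u)
        (layer-≤ ψ (w-fixed ψ) s x s′ y nonIso ψu≡v))

-- Twin covers and the two bounds

module MinimumTwinCover (G : Graph) (symG : Symmetric G) {S : Subset (n G)}
  (S-min : IsMinTwinCover G S) (S-det : IsDeterminingSet G S) {d : ℕ} (det≡d : IsDetNumber G d) where

  twinCover-≥ : ∀ T → IsTwinCover G T → d ≤ ∣ T ∣
  twinCover-≥ T cover = ≤-trans (proj₂ det≡d S S-det) (proj₂ S-min T cover)

  ∣S∣≡d : ∣ S ∣ ≡ d
  ∣S∣≡d with proj₁ det≡d
  ... | D , D-det , ∣D∣≡d = ≤-antisym
    (subst (∣ S ∣ ≤_) ∣D∣≡d (proj₂ S-min D (determining⇒twinCover symG D-det)))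
    (proj₂ det≡d S S-det)

  module _ {i₁ : Fin (n G)} (iso₁ : Isolated G i₁) where

    twinCover⊇isolated⇒> : ∀ T → IsTwinCover G T → (∀ x → Isolated G x → x ∈ T) → d < ∣ T ∣
    twinCover⊇isolated⇒> T cover isolated∈T = begin-strict
      d               ≤⟨ twinCover-≥ (T - i₁) (twinCover-remove G cover twins∈T) ⟩
      ∣ T - i₁ ∣      <⟨ x∈p⇒∣p-x∣<∣p∣ (isolated∈T i₁ iso₁) ⟩
      ∣ T ∣           ∎
      where
      open ≤-Reasoning
      twins∈T : ∀ y → y ≢ i₁ → Twins G i₁ y → y ∈ T
      twins∈T y _ tw = isolated∈T y (twins⇒isolated G tw iso₁)

    isolated-outside-S : ∃ λ i₀ → Isolated G i₀ × i₀ ∉ S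
    isolated-outside-S with any? (λ j → isolated? G j ×-dec ¬? (j ∈? S))
    ... | yes found = found
    ... | no  none  = contradiction (twinCover⊇isolated⇒> S (proj₁ S-min) isolated∈S) (<-irrefl (sym ∣S∣≡d))
      where
      isolated∈S : ∀ x → Isolated G x → x ∈ S
      isolated∈S x iso = decidable-stable (x ∈? S) λ x∉S → none (x , iso , x∉S)

    i₀ : Fin (n G)
    i₀ = proj₁ isolated-outside-S

    i₀-isolated : Isolated G i₀
    i₀-isolated = proj₁ (proj₂ isolated-outside-S)

    i₀∉S : i₀ ∉ S
    i₀∉S = proj₂ (proj₂ isolated-outside-S)

    isolated∉S⇒≡i₀ : ∀ j → Isolated G j → j ∉ S → j ≡ i₀
    isolated∉S⇒≡i₀ j iso j∉S = isolated-outside-twinCover G (proj₁ S-min) iso i₀-isolated j∉S i₀∉S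

    module LowerBound (t : ℕ) (D : Subset (n (μ t G))) (D-det : IsDeterminingSet (μ t G) D) where
      open Mycielskian t G symG

      layer-cover : ∀ s → IsTwinCover G (lookup (layers D) s)
      layer-cover s a b a≢b tw
        with determining⇒twinCover symmetric D-det (u s a) (u s b)
               (a≢b ∘ proj₂ ∘ u-injective s a s b) (twins-lift s tw)
      ... | inj₁ ua∈D = inj₁ (∈-layers s a ua∈D)
      ... | inj₂ ub∈D = inj₂ (∈-layers s b ub∈D)

      MissesIsolated : Fin (suc t) → Set
      MissesIsolated s = toℕ s ≢ t × ∃ λ j → Isolated G j × j ∉ lookup (layers D) s

      missesIsolated? : Decidable MissesIsolated
      missesIsolated? s = ¬? (toℕ s ≟ℕ t) ×-dec any? λ j → isolated? G j ×-dec ¬? (j ∈? lookup (layers D) s)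

      missesIsolated-unique : ∀ {a b} → MissesIsolated a → MissesIsolated b → a ≡ b
      missesIsolated-unique {a} {b} (¬topᵃ , j , isoʲ , j∉) (¬topᵇ , k , isoᵏ , k∉) =
        proj₁ (u-injective a j b k
        (isolated-outside-twinCover μG (determining⇒twinCover symmetric D-det)
          (isolated-lift a j ¬topᵃ isoʲ) (isolated-lift b k ¬topᵇ isoᵏ) (j∉ ∘ ∈-layers a j) (k∉ ∘ ∈-layers b k)))

      allButOne : ∃ λ s₀ → ∀ s → s ≢ s₀ → ¬ MissesIsolated s
      allButOne = atMostOne⇒allButOne missesIsolated? missesIsolated-unique

      s₀ : Fin (suc t)
      s₀ = proj₁ allButOne

      E : Subset (suc t)
      E = ⁅ s₀ ⁆ ∪ ⁅ top ⁆

      ∣E∣≤2 : ∣ E ∣ ≤ 2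
      ∣E∣≤2 = ≤-trans (∣p∪q∣≤∣p∣+∣q∣ ⁅ s₀ ⁆ ⁅ top ⁆) (≤-reflexive (cong₂ _+_ (∣⁅x⁆∣≡1 s₀) (∣⁅x⁆∣≡1 top)))

      layer-> : ∀ s → s ∉ E → d < ∣ lookup (layers D) s ∣
      layer-> s s∉E = twinCover⊇isolated⇒> _ (layer-cover s) λ j iso →
        decidable-stable (j ∈? _) λ j∉ → proj₂ allButOne s s≢s₀ (¬top , j , iso , j∉)
        where
        s≢s₀ : s ≢ s₀
        s≢s₀ refl = s∉E (x∈p∪q⁺ (inj₁ (x∈⁅x⁆ s₀)))
        ¬top : toℕ s ≢ t
        ¬top s≡t = s∉E (x∈p∪q⁺ (inj₂ (subst (_∈ ⁅ top ⁆) (sym (top-unique s s≡t)) (x∈⁅x⁆ top))))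

      lower-bound : (t + 1) * d + t ∸ 1 ≤ ∣ D ∣
      lower-bound = [1+t][1+d]≤2+m⇒[t+1]d+t∸1≤m t d ∣ D ∣ (begin
        suc t * suc d                  ≤⟨ ∣concat∣-lowerBound (layers D) E (λ s → twinCover-≥ _ (layer-cover s)) layer-> ⟩
        ∣ E ∣ + ∣ concat (layers D) ∣  ≤⟨ +-mono-≤ ∣E∣≤2 (∣concat-layers∣≤∣D∣ D) ⟩
        2 + ∣ D ∣                      ∎)
        where open ≤-Reasoning

    module UpperBound (t′ : ℕ) {x₀ y₀ : Fin (n G)} (x₀≢y₀ : x₀ ≢ y₀) where
      open Mycielskian (suc t′) G symG
      open Rigidity x₀≢y₀ iso₁

      S⁺ : Subset (n G)
      S⁺ = S ∪ ⁅ i₀ ⁆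

      upperLayers : ∀ k → Vec (Subset (n G)) (suc k)
      upperLayers zero    = S ∷ []
      upperLayers (suc k) = S⁺ ∷ upperLayers k

      S″ : Subset (n μG)
      S″ = fromLayers (S ∷ upperLayers t′)

      S⊆upperLayers : ∀ k s → S ⊆ lookup (upperLayers k) s
      S⊆upperLayers zero    zero    = id
      S⊆upperLayers (suc k) zero    = p⊆p∪q ⁅ i₀ ⁆
      S⊆upperLayers (suc k) (suc s) = S⊆upperLayers k s

      i₀∈upperLayers : ∀ k s → toℕ s ≢ k → i₀ ∈ lookup (upperLayers k) s
      i₀∈upperLayers zero    zero    s≢0 = contradiction refl s≢0
      i₀∈upperLayers (suc k) zero    _   = x∈p∪q⁺ (inj₂ (x∈⁅x⁆ i₀))
      i₀∈upperLayers (suc k) (suc s) s≢k = i₀∈upperLayers k s (s≢k ∘ cong suc)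

      S⊆S″ : ∀ s {i} → i ∈ S → u s i ∈ S″
      S⊆S″ zero    {i} i∈S = ∈-fromLayers (S ∷ upperLayers t′) zero i i∈S
      S⊆S″ (suc s) {i} i∈S = ∈-fromLayers (S ∷ upperLayers t′) (suc s) i (S⊆upperLayers t′ s i∈S)

      i₀∈S″ : ∀ s → toℕ (suc s) ≢ suc t′ → u (suc s) i₀ ∈ S″
      i₀∈S″ s ¬top = ∈-fromLayers (S ∷ upperLayers t′) (suc s) i₀ (i₀∈upperLayers t′ s (¬top ∘ cong suc))

      ∣concat-upperLayers∣ : ∀ k → ∣ concat (upperLayers k) ∣ ≡ k * suc d + d
      ∣concat-upperLayers∣ zero    = trans (∣p++q∣≡∣p∣+∣q∣ S []) (trans (+-identityʳ ∣ S ∣) ∣S∣≡d)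
      ∣concat-upperLayers∣ (suc k) = begin
        ∣ S⁺ ++ concat (upperLayers k) ∣          ≡⟨ ∣p++q∣≡∣p∣+∣q∣ S⁺ (concat (upperLayers k)) ⟩
        ∣ S⁺ ∣ + ∣ concat (upperLayers k) ∣       ≡⟨ cong₂ _+_ (trans (∣p∪⁅x⁆∣≡1+∣p∣ S i₀∉S) (cong suc ∣S∣≡d)) (∣concat-upperLayers∣ k) ⟩
        suc d + (k * suc d + d)                   ≡⟨ +-assoc (suc d) (k * suc d) d ⟨
        suc k * suc d + d                         ∎
        where open ≡-Reasoning

      ∣S″∣ : ∣ S″ ∣ ≡ (suc t′ + 1) * d + suc t′ ∸ 1
      ∣S″∣ = begin
        ∣ S ++ concat (upperLayers t′) ∣          ≡⟨ ∣p++q∣≡∣p∣+∣q∣ S (concat (upperLayers t′)) ⟩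
        ∣ S ∣ + ∣ concat (upperLayers t′) ∣       ≡⟨ cong₂ _+_ ∣S∣≡d (∣concat-upperLayers∣ t′) ⟩
        d + (t′ * suc d + d)                      ≡⟨ d+[t*[1+d]+d]≡[2+t]d+[1+t]∸1 t′ d ⟩
        (suc t′ + 1) * d + suc t′ ∸ 1             ∎
        where open ≡-Reasoning

      isolated∉S″ : ∀ v → Isolated μG v → v ∉ S″ → v ≡ u zero i₀
      isolated∉S″ v iso v∉S″ with isolated-vertex v iso
      ... | s , j , refl , ¬top , isoʲ with isolated∉S⇒≡i₀ j isoʲ (v∉S″ ∘ S⊆S″ s)
      ...   | refl with s
      ...     | zero   = refl
      ...     | suc s′ = contradiction (i₀∈S″ s′ ¬top) v∉S″

      soleNeighbour∉S″ : ∀ v → SoleNeighbour μG v w → v ∉ S″ → v ≡ u top i₀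
      soleNeighbour∉S″ v sole v∉S″ with soleNeighbour-w v sole
      ... | j , refl , isoʲ = cong (u top) (isolated∉S⇒≡i₀ j isoʲ (v∉S″ ∘ S⊆S″ top))

      module Fixed (φ : Automorphism μG) (fixes : ∀ v → v ∈ S″ → f φ v ≡ v) where

        fixes-isolated : ∀ s x → toℕ s ≢ suc t′ → Isolated G x → f φ (u s x) ≡ u s x
        fixes-isolated s x ¬top iso = fixes-class-with-one-outsider φ fixes (Isolated μG) (isolated-image φ _)
          (λ isoᵛ isoᵛ′ v∉ v′∉ → trans (isolated∉S″ _ isoᵛ v∉) (sym (isolated∉S″ _ isoᵛ′ v′∉)))
          (isolated-lift s x ¬top iso)

        fixes-top-isolated : ∀ x → Isolated G x → f φ (u top x) ≡ u top x
        fixes-top-isolated x iso = fixes-class-with-one-outsider φ fixes (λ v → SoleNeighbour μG v w)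
          (λ {v} sole → subst (SoleNeighbour μG (f φ v)) (w-fixed φ) (soleNeighbour-image φ v w sole))
          (λ sole sole′ v∉ v′∉ → trans (soleNeighbour∉S″ _ sole v∉) (sym (soleNeighbour∉S″ _ sole′ v′∉)))
          (soleNeighbour-top x iso)

        layer₀-image : ∀ x → ∃ λ y → f φ (u zero x) ≡ u zero y
        layer₀-image x with isolated⊎nonIsolated G x
        ... | inj₁ iso    = x , fixes-isolated zero x (λ ()) iso
        ... | inj₂ nonIso = layer-preserved φ zero x nonIso

      S″-determining : IsDeterminingSet μG S″
      S″-determining φ fixes = all-fixed
        where
        open Fixed φ fixes
        fixes⁻¹ : ∀ v → v ∈ S″ → g φ v ≡ v
        fixes⁻¹ v v∈S″ = trans (cong (g φ) (sym (fixes v v∈S″))) (g∘f φ v)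
        π-data : Σ (Automorphism G) λ π → ∀ x → f φ (u zero x) ≡ u zero (f π x)
        π-data = restrict₀ φ layer₀-image (Fixed.layer₀-image (φ ⁻¹) fixes⁻¹)
        π : Automorphism G
        π = proj₁ π-data
        π-id : ∀ x → f π x ≡ x
        π-id = S-det π λ x x∈S →
          proj₂ (u-injective zero (f π x) zero x (trans (sym (proj₂ π-data x)) (fixes _ (S⊆S″ zero x∈S))))
        layer₀-fixed : FixesLayer φ zero
        layer₀-fixed x = trans (proj₂ π-data x) (cong (u zero) (π-id x))
        layer-step : ∀ s → FixesLayer φ (inject₁ s) → FixesLayer φ (suc s)
        layer-step s below x with isolated⊎nonIsolated G x
        ... | inj₁ iso with toℕ (suc s) ≟ℕ suc t′
        ...   | yes s≡t = subst (λ r → f φ (u r x) ≡ u r x) (sym (top-unique (suc s) s≡t)) (fixes-top-isolated x iso)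
        ...   | no  ¬top = fixes-isolated (suc s) x ¬top iso
        layer-step s below x | inj₂ nonIso with layer-preserved φ (suc s) x nonIso
        ... | y , φu≡u′ with x ≟ y
        ...   | yes refl = φu≡u′
        ...   | no  x≢y with proj₁ S-min x y x≢y (twins-from-layer-below φ s below x y φu≡u′)
        ...     | inj₁ x∈S = fixes _ (S⊆S″ (suc s) x∈S)
        ...     | inj₂ y∈S = image∈⇒fixed φ fixes (subst (_∈ S″) (sym φu≡u′) (S⊆S″ (suc s) y∈S))
        all-fixed : ∀ v → f φ v ≡ v
        all-fixed v with view v
        ... | w-view     = w-fixed φ
        ... | u-view s x = <-weakInduction (FixesLayer φ) layer₀-fixed layer-step s x

corollary3p18 : (G : Graph) → IsSimple G
    → Σ (Fin (n G)) (Isolated G)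
    → HasDistinctTwins G
    → Σ (Subset (n G)) (λ S → IsMinTwinCover G S × IsDeterminingSet G S)
    → (t : ℕ) → 1 ≤ t
    → (d : ℕ) → IsDetNumber G d
    → IsDetNumber (μ t G) ((t + 1) * d + t ∸ 1)
corollary3p18 G (symG , _) (_ , iso₁) (_ , _ , x₀≢y₀ , _) (_ , S-min , S-det) (suc t′) _ d det≡d =
  (S″ , S″-determining , ∣S″∣) , λ D D-det → LowerBound.lower-bound iso₁ (suc t′) D D-det
  where
  open MinimumTwinCover G symG S-min S-det det≡d
  open UpperBound iso₁ t′ x₀≢y₀
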